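{- Let $S,T$ be normal trees on $2\times\omega$, and let $G_S$ and $G_T$ be the ordered combinatorial trees associated to them by the construction described below. If $S\neq T$, then $G_S\not\cong G_T$ (i.e. there is no bijection between their vertex sets preserving both the graph relation and the order relation).
   Context: For $s,t\in{}^{<\omega}\omega$ of the same length write $s\leq t$ if $s(i)\leq t(i)$ for all $i$. A tree $T$ on $2\times\omega$ (a set of pairs $(u,s)$ with $u\in{}^{<\omega}2$, $s\in{}^{<\omega}\omega$, $|u|=|s|$, closed under initial segments) is normal if $(u,s)\in T$ and $s\leq t$ imply $(u,t)\in T$. An ordered combinatorial tree is a structure $\langle U_G,G,\leq_G\rangle$ where $\langle U_G,G\rangle$ is a connected acyclic graph and $\leq_G$ is a transitive relation on $U_G$. Construction of $G_T$ for a normal tree $T$ on $2\times\omega$: (i) fix an enumeration $\theta\colon{}^{<\omega}2\to\omega$ such that $|s|\leq|t|$ implies $\theta(s)\leq\theta(t)$; (ii) take the vertices ${}^{<\omega}\omega$ and, for each $s\in{}^{<\omega}\omega\setminus\{\emptyset\}$, a new vertex $s^*$, with edges between $s^*$ and $s$ and between $s^*$ and the predecessor $s^-$ of $s$ (i.e. $s$ with its last entry removed); (iii) for each $(u,s)\in T$ add vertices $(u,s,x)$, where $x$ is either $0^{(k)}$ (the sequence of $k$ zeros, $k\in\omega$) or the sequence consisting of $2\theta(u)+2$ zeros, followed by a $1$, followed by $k$ zeros; link $(u,s,\emptyset)$ to $s$ and $(u,s,x)$ to $(u,s,x^-)$, where $x^-$ is $x$ with its last entry removed. The order $\leq_T$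 on the vertices: for $s,t\in{}^{<\omega}\omega$ put $s\preceq t$ iff $|s|<|t|$, or $|s|=|t|$ and $s\leq_{lex}t$ ($\prec$ its strict part), and use the same definition of $\preceq$ for sequences in ${}^{<\omega}2$. Then $g\leq_T g'$ holds exactly in the following cases (with $s,t\in{}^{<\omega}\omega$, $u,v,x,y\in{}^{<\omega}2$): $g=s$ and $g'=t^*$ or $g'=(v,t,y)$; $g=s^*$ and $g'=(v,t,y)$; $g=s$, $g'=t$ and $s\preceq t$; $g=s^*$, $g'=t^*$ and $s\preceq t$; $g=(u,s,x)$, $g'=(v,t,y)$ and ($s\prec t$, or $s=t$ and $u\prec v$, or $s=t$, $u=v$ and $x\preceq y$). In particular $\leq_S$ and $\leq_T$ coincide on ${}^{<\omega}\omega$. -}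

module Defs where

open import Data.Bool using (Bool; true; false) renaming (_<_ to _<ᵇ_)
open import Data.Nat using (ℕ; _≤_; _<_; _+_; _*_)
open import Data.List using (List; []; _∷_; _∷ʳ_; length; take; replicate; _++_)
open import Data.List.Relation.Binary.Pointwise using (Pointwise)
open import Data.Product using (Σ; ∃; _×_; _,_)
open import Data.Sum using (_⊎_)
open import Data.Unit using (⊤)
open import Relation.Binary.PropositionalEquality using (_≡_; _≢_)
open import Function.Bundles using (_⇔_)

-- ^{<ω}2 is List Bool (0 = false, 1 = true); ^{<ω}ω is List ℕ.

Tree : Set₁
Tree = List Bool → List ℕ → Set

-- s ≤ t pointwise (this forces |s| = |t|)
_≤ₚ_ : List ℕ → List ℕ → Set
s ≤ₚ t = Pointwise _≤_ s t

record IsNormalTree (T : Tree) : Set where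
  field
    sameLength : ∀ u s → T u s → length u ≡ length s
    initSeg    : ∀ u s k → T u s → T (take k u) (take k s)
    normal     : ∀ u s t → T u s → s ≤ₚ t → T u t

data LexLeq {A : Set} (_≺_ : A → A → Set) : List A → List A → Set where
  []≤   : ∀ {ys} → LexLeq _≺_ [] ys
  here  : ∀ {x y xs ys} → x ≺ y → LexLeq _≺_ (x ∷ xs) (y ∷ ys)
  there : ∀ {x xs ys} → LexLeq _≺_ xs ys → LexLeq _≺_ (x ∷ xs) (x ∷ ys)

_⪯ₙ_ : List ℕ → List ℕ → Set
s ⪯ₙ t = (length s < length t) ⊎ (length s ≡ length t × LexLeq _<_ s t)

_≺ₙ_ : List ℕ → List ℕ → Set
s ≺ₙ t = s ⪯ₙ t × s ≢ t

_⪯₂_ : List Bool → List Bool → Set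
s ⪯₂ t = (length s < length t) ⊎ (length s ≡ length t × LexLeq _<ᵇ_ s t)

_≺₂_ : List Bool → List Bool → Set
s ≺₂ t = s ⪯₂ t × s ≢ t

data Raw : Set where
  node : List ℕ → Raw
  star : List ℕ → Raw
  hair : List Bool → List ℕ → List Bool → Raw

AllowedX : (List Bool → ℕ) → List Bool → List Bool → Set
AllowedX θ u x =
  (∃ λ k → x ≡ replicate k false) ⊎
  (∃ λ k → x ≡ replicate (2 * θ u + 2) false ++ (true ∷ replicate k false))

Valid : (List Bool → ℕ) → Tree → Raw → Set
Valid θ T (node s)     = ⊤
Valid θ T (star s)     = s ≢ []
Valid θ T (hair u s x) = T u s × AllowedX θ u x

data Edge : Raw → Raw → Set where
  star-node : ∀ s → Edge (star s) (node s)
  star-pred : ∀ s n → Edge (star (s ∷ʳ n)) (node s)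
  hair-root : ∀ u s → Edge (hair u s []) (node s)
  hair-pred : ∀ u s x b → Edge (hair u s (x ∷ʳ b)) (hair u s x)

Adj : Raw → Raw → Set
Adj a b = Edge a b ⊎ Edge b a

data Ord : Raw → Raw → Set where
  node-star : ∀ s t → Ord (node s) (star t)
  node-hair : ∀ s v t y → Ord (node s) (hair v t y)
  star-hair : ∀ s v t y → Ord (star s) (hair v t y)
  node-node : ∀ s t → s ⪯ₙ t → Ord (node s) (node t)
  star-star : ∀ s t → s ⪯ₙ t → Ord (star s) (star t)
  hair-hair : ∀ u s x v t y →
    (s ≺ₙ t ⊎ (s ≡ t × u ≺₂ v) ⊎ (s ≡ t × u ≡ v × x ⪯₂ y)) →
    Ord (hair u s x) (hair v t y)

record Iso (θ : List Bool → ℕ) (S T : Tree) : Set where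
  field
    f      : Raw → Raw
    g      : Raw → Raw
    f-ok   : ∀ a → Valid θ S a → Valid θ T (f a)
    g-ok   : ∀ b → Valid θ T b → Valid θ S (g b)
    gf     : ∀ a → Valid θ S a → g (f a) ≡ a
    fg     : ∀ b → Valid θ T b → f (g b) ≡ b
    adj    : ∀ a b → Valid θ S a → Valid θ S b → Adj a b ⇔ Adj (f a) (f b)
    ord    : ∀ a b → Valid θ S a → Valid θ S b → Ord a b ⇔ Ord (f a) (f b)

record IsEnumeration (θ : List Bool → ℕ) : Set where
  field
    injective  : ∀ u v → θ u ≡ θ v → u ≡ v
    surjective : ∀ n → ∃ λ u → θ u ≡ n
    byLength   : ∀ u v → length u < length v → θ u < θ v

module Submission where

-- Proof idea.  Let φ = (f , g) be an isomorphism G_S ≅ G_T.  We show S ⊆ T; applying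
-- this to the inverse isomorphism gives T ⊆ S, so S = T.
--
-- 1. The vertices s and s* form an initial segment of ≤_T (the "core") on which the
--    order is total and whose strict part is well-founded: it is "length, then
--    lexicographic" on ^{<ω}ω, with all s below all s*.  An order isomorphism fixes
--    a well-ordered initial segment pointwise, so f and g are the identity on the core.
-- 2. Take (u , s) ∈ S.  The hair (u , s , ∅) is adjacent to s = f(s) and is not a core
--    vertex, so f(u , s , ∅) = (v , s , ∅) for some v.  Following the zero ray, f maps
--    (u , s , 0^(j)) to (v , s , 0^(j)) for every j ≤ K = 2θ(u)+2: the only way to
--    leave the v-ray early is at the depth 2θ(v)+2 of the branch of v, and pulling that
--    step back with g shows that this depth is K.
-- 3. At depth K both children of (u , s , 0^(K)) are sent to children of (v , s , 0^(K));
--    they cannot both go to the zero child, so one goes to the branch child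
--    (v , s , 0^(K) 1), which then exists in G_T.  Hence K = 2θ(v)+2, so u = v since θ
--    is injective, and (u , s) ∈ T.

open import Defs
open import Data.Nat using (ℕ; zero; suc; _+_; _*_; _<_; _≤_; z≤n; s≤s)
open import Data.Nat.Properties
  using (<-cmp; <-irrefl; <-asym; suc-injective; ≤-reflexive; ≤-trans; ≤-refl; <⇒≤;
         n≤1+n; m≤n⇒m<n∨m≡n; +-cancelʳ-≡; *-cancelˡ-≡)
open import Data.Nat.Induction using (<-wellFounded)
open import Data.Bool using (Bool; true; false)
open import Data.List using (List; []; _∷_; _∷ʳ_; length; replicate; _++_)
open import Data.List.Properties using (∷-injectiveʳ; ∷ʳ-injectiveˡ; ∷ʳ-injectiveʳ)
open import Data.Product using (∃; _×_; _,_; proj₁; proj₂)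
open import Data.Sum using (_⊎_; inj₁; inj₂)
import Data.Sum as Sum
open import Data.Empty using (⊥; ⊥-elim)
open import Data.Unit using (⊤; tt)
open import Function.Bundles using (_⇔_; mk⇔; Equivalence)
open import Relation.Nullary using (¬_)
open import Relation.Binary.PropositionalEquality
  using (_≡_; _≢_; refl; sym; trans; cong; subst; subst₂)
open import Relation.Binary.Definitions using (tri<; tri≈; tri>)
open import Induction.WellFounded using (Acc; acc; WellFounded)

-- The strict order "shorter, or same length and lexicographically smaller" on ^{<ω}ω,
-- in a form suited to induction (a tail comparison may itself be by length).
data _⊏_ : List ℕ → List ℕ → Set where
  shorter : ∀ {s t} → length s < length t → s ⊏ t
  head<   : ∀ {x y xs ys} → x < y → length xs ≡ length ys → (x ∷ xs) ⊏ (y ∷ ys)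
  tail⊏   : ∀ {x xs ys} → xs ⊏ ys → (x ∷ xs) ⊏ (x ∷ ys)

⊏-length : ∀ {s t} → s ⊏ t → length s ≤ length t
⊏-length (shorter l) = <⇒≤ l
⊏-length (head< _ e) = ≤-reflexive (cong suc e)
⊏-length (tail⊏ p)   = s≤s (⊏-length p)

∷-acc : ∀ {n} → (∀ {s} → length s ≤ n → Acc _⊏_ s) →
  ∀ {x xs} → Acc _<_ x → Acc _⊏_ xs → length xs ≤ n → Acc _⊏_ (x ∷ xs)

∷-below : ∀ {n} → (∀ {s} → length s ≤ n → Acc _⊏_ s) →
  ∀ {x xs} → Acc _<_ x → Acc _⊏_ xs → length xs ≤ n → ∀ {s} → s ⊏ (x ∷ xs) → Acc _⊏_ s
∷-below short _ _ len (shorter (s≤s l)) = short (≤-trans l len)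
∷-below short (acc below-x) _ len (head< y<x e) =
  ∷-acc short (below-x y<x) (short len') len'
  where len' = ≤-trans (≤-reflexive e) len
∷-below short acc-x (acc below-xs) len (tail⊏ p) =
  ∷-acc short acc-x (below-xs p) (≤-trans (⊏-length p) len)

∷-acc short acc-x acc-xs len = acc (∷-below short acc-x acc-xs len)

acc-upto : ∀ n {s} → length s ≤ n → Acc _⊏_ s
acc-upto n       {[]}     _       = acc λ { (shorter ()) }
acc-upto (suc n) {x ∷ xs} (s≤s l) = ∷-acc (acc-upto n) (<-wellFounded x) (acc-upto n l) l

⊏-wellFounded : WellFounded _⊏_
⊏-wellFounded s = acc-upto (length s) ≤-refl

lex-total : ∀ (s t : List ℕ) → LexLeq _<_ s t ⊎ LexLeq _<_ t s
lex-total []      t       = inj₁ []≤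
lex-total (x ∷ s) []      = inj₂ []≤
lex-total (x ∷ s) (y ∷ t) with <-cmp x y
... | tri< x<y _ _ = inj₁ (here x<y)
... | tri> _ _ y<x = inj₂ (here y<x)
... | tri≈ _ refl _ = Sum.map there there (lex-total s t)

lex-antisym : ∀ {s t : List ℕ} → LexLeq _<_ s t → LexLeq _<_ t s → s ≡ t
lex-antisym []≤           []≤       = refl
lex-antisym (here x<y)    (here y<x) = ⊥-elim (<-asym x<y y<x)
lex-antisym (here x<x)    (there _)  = ⊥-elim (<-irrefl refl x<x)
lex-antisym (there _)     (here x<x) = ⊥-elim (<-irrefl refl x<x)
lex-antisym (there {x} l) (there m)  = cong (x ∷_) (lex-antisym l m)

⪯ₙ-total : ∀ s t → s ⪯ₙ t ⊎ t ⪯ₙ s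
⪯ₙ-total s t with <-cmp (length s) (length t)
... | tri< l _ _ = inj₁ (inj₁ l)
... | tri> _ _ l = inj₂ (inj₁ l)
... | tri≈ _ e _ = Sum.map (λ l → inj₂ (e , l)) (λ l → inj₂ (sym e , l)) (lex-total s t)

⪯ₙ-antisym : ∀ {s t} → s ⪯ₙ t → t ⪯ₙ s → s ≡ t
⪯ₙ-antisym (inj₁ l)       (inj₁ m)       = ⊥-elim (<-asym l m)
⪯ₙ-antisym (inj₁ l)       (inj₂ (e , _)) = ⊥-elim (<-irrefl (sym e) l)
⪯ₙ-antisym (inj₂ (e , _)) (inj₁ m)       = ⊥-elim (<-irrefl (sym e) m)
⪯ₙ-antisym (inj₂ (_ , l)) (inj₂ (_ , m)) = lex-antisym l m

lex-split : ∀ {s t} → LexLeq _<_ s t → length s ≡ length t → s ≡ t ⊎ s ⊏ t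
lex-split {t = []}    []≤ _  = inj₁ refl
lex-split {t = _ ∷ _} []≤ ()
lex-split (here x<y)    e = inj₂ (head< x<y (suc-injective e))
lex-split (there {x} l) e = Sum.map (cong (x ∷_)) tail⊏ (lex-split l (suc-injective e))

⪯ₙ-split : ∀ {s t} → s ⪯ₙ t → s ≡ t ⊎ s ⊏ t
⪯ₙ-split (inj₁ l)       = inj₂ (shorter l)
⪯ₙ-split (inj₂ (e , l)) = lex-split l e

Core : Raw → Set
Core (node s)     = ⊤
Core (star s)     = s ≢ []
Core (hair _ _ _) = ⊥

core-valid : ∀ {θ} (R : Tree) {x} → Core x → Valid θ R x
core-valid R {node s} _  = tt
core-valid R {star s} ne = ne

data _⊏ᶜ_ : Raw → Raw → Set where
  node⊏node : ∀ {s t} → s ⊏ t → node s ⊏ᶜ node t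
  node⊏star : ∀ {s t} → node s ⊏ᶜ star t
  star⊏star : ∀ {s t} → s ⊏ t → star s ⊏ᶜ star t

node-acc : ∀ {s} → Acc _⊏_ s → Acc _⊏ᶜ_ (node s)
node-acc (acc below) = acc λ { (node⊏node p) → node-acc (below p) }

star-acc : ∀ {s} → Acc _⊏_ s → Acc _⊏ᶜ_ (star s)
star-acc (acc below) = acc λ where
  node⊏star     → node-acc (⊏-wellFounded _)
  (star⊏star p) → star-acc (below p)

⊏ᶜ-wellFounded : WellFounded _⊏ᶜ_
⊏ᶜ-wellFounded (node s)     = node-acc (⊏-wellFounded s)
⊏ᶜ-wellFounded (star s)     = star-acc (⊏-wellFounded s)
⊏ᶜ-wellFounded (hair _ _ _) = acc λ ()

core-total : ∀ {x} → Core x → ∀ z → Ord x z ⊎ Ord z x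
core-total {node s} _ (node t)     = Sum.map (node-node s t) (node-node t s) (⪯ₙ-total s t)
core-total {node s} _ (star t)     = inj₁ (node-star s t)
core-total {node s} _ (hair v t y) = inj₁ (node-hair s v t y)
core-total {star s} _ (node t)     = inj₂ (node-star t s)
core-total {star s} _ (star t)     = Sum.map (star-star s t) (star-star t s) (⪯ₙ-total s t)
core-total {star s} _ (hair v t y) = inj₁ (star-hair s v t y)

core-antisym : ∀ {x z} → Core x → Ord x z → Ord z x → x ≡ z
core-antisym {node s} _ (node-node _ _ p) (node-node _ _ q) = cong node (⪯ₙ-antisym p q)
core-antisym {star s} _ (star-star _ _ p) (star-star _ _ q) = cong star (⪯ₙ-antisym p q)

core-below : ∀ {θ} (R : Tree) {x y} → Core x → Valid θ R y → Ord y x →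
  y ≡ x ⊎ (Core y × y ⊏ᶜ x)
core-below R {node s} _ _  (node-node t _ p) =
  Sum.map (cong node) (λ t⊏s → tt , node⊏node t⊏s) (⪯ₙ-split p)
core-below R {star s} _ _  (node-star t _)   = inj₂ (tt , node⊏star)
core-below R {star s} _ vy (star-star t _ p) =
  Sum.map (cong star) (λ t⊏s → vy , star⊏star t⊏s) (⪯ₙ-split p)

node-neighbour : ∀ {w s} → Adj w (node s) →
  (∃ λ t → w ≡ star t) ⊎ (∃ λ v → w ≡ hair v s [])
node-neighbour (inj₁ (star-node s))   = inj₁ (s , refl)
node-neighbour (inj₁ (star-pred s n)) = inj₁ (s ∷ʳ n , refl)
node-neighbour (inj₁ (hair-root v s)) = inj₂ (v , refl)

hair-neighbour : ∀ {w v s x} → Adj w (hair v s x) →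
  (w ≡ node s) ⊎
  (∃ λ y → ∃ λ b → x ≡ y ∷ʳ b × w ≡ hair v s y) ⊎
  (∃ λ b → w ≡ hair v s (x ∷ʳ b))
hair-neighbour (inj₁ (hair-pred v s x b)) = inj₂ (inj₂ (b , refl))
hair-neighbour (inj₂ (hair-root v s))     = inj₁ refl
hair-neighbour (inj₂ (hair-pred v s y b)) = inj₂ (inj₁ (y , b , refl , refl))

hair-label-injective : ∀ {u s x v t y} → hair u s x ≡ hair v t y → x ≡ y
hair-label-injective refl = refl

zeros : ℕ → List Bool
zeros k = replicate k false

zeros-suc : ∀ k → zeros (suc k) ≡ zeros k ∷ʳ false
zeros-suc zero    = refl
zeros-suc (suc k) = cong (false ∷_) (zeros-suc k)

zeros-parent : ∀ k y b → zeros k ≡ y ∷ʳ b → ∃ λ k' → k ≡ suc k' × y ≡ zeros k'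
zeros-parent zero    []      b ()
zeros-parent zero    (_ ∷ _) b ()
zeros-parent (suc k) y       b e = k , refl , sym (∷ʳ-injectiveˡ (zeros k) y (trans (sym (zeros-suc k)) e))

snoc-not-zeros : ∀ k b → zeros (suc k) ∷ʳ b ≢ zeros k
snoc-not-zeros zero    b ()
snoc-not-zeros (suc k) b e = snoc-not-zeros k b (∷-injectiveʳ e)

zeros-no-one : ∀ j k → zeros j ≢ zeros k ∷ʳ true
zeros-no-one zero    zero    ()
zeros-no-one zero    (suc k) ()
zeros-no-one (suc j) zero    ()
zeros-no-one (suc j) (suc k) e = zeros-no-one j k (∷-injectiveʳ e)

first-one : ∀ k m (xs ys : List Bool) → zeros k ++ true ∷ xs ≡ zeros m ++ true ∷ ys → k ≡ m
first-one zero    zero    xs ys e = refl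
first-one zero    (suc m) xs ys ()
first-one (suc k) zero    xs ys ()
first-one (suc k) (suc m) xs ys e = cong suc (first-one k m xs ys (∷-injectiveʳ e))

ray-valid : ∀ θ (R : Tree) {u s} → R u s → ∀ j → Valid θ R (hair u s (zeros j))
ray-valid θ R Ru j = Ru , inj₁ (j , refl)

zero-child-valid : ∀ θ (R : Tree) {u s} → R u s → ∀ k → Valid θ R (hair u s (zeros k ∷ʳ false))
zero-child-valid θ R Ru k = Ru , inj₁ (suc k , sym (zeros-suc k))

branch-child-valid : ∀ θ (R : Tree) {u s} → R u s → Valid θ R (hair u s (zeros (2 * θ u + 2) ∷ʳ true))
branch-child-valid θ R Ru = Ru , inj₂ (0 , refl)

branch-depth : ∀ θ v k → AllowedX θ v (zeros k ∷ʳ true) → k ≡ 2 * θ v + 2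
branch-depth θ v k (inj₁ (j , e)) = ⊥-elim (zeros-no-one j k (sym e))
branch-depth θ v k (inj₂ (j , e)) = first-one k _ [] _ e

branch-depth-injective : ∀ {θ} → IsEnumeration θ → ∀ u v → 2 * θ u + 2 ≡ 2 * θ v + 2 → u ≡ v
branch-depth-injective {θ} en u v e =
  IsEnumeration.injective en u v (*-cancelˡ-≡ (θ u) (θ v) 2 (+-cancelʳ-≡ 2 (2 * θ u) (2 * θ v) e))

symIso : ∀ {θ S T} → Iso θ S T → Iso θ T S
symIso {θ} {S} {T} φ = record
  { f = g ; g = f ; f-ok = g-ok ; g-ok = f-ok ; gf = fg ; fg = gf
  ; adj = transport Adj adj ; ord = transport Ord ord }
  where
  open Iso φ
  transport : (Q : Raw → Raw → Set) →
    (∀ a b → Valid θ S a → Valid θ S b → Q a b ⇔ Q (f a) (f b)) →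
    ∀ a b → Valid θ T a → Valid θ T b → Q a b ⇔ Q (g a) (g b)
  transport Q pres a b va vb = mk⇔
    (λ q → Equivalence.from (pres (g a) (g b) (g-ok a va) (g-ok b vb))
             (subst₂ Q (sym (fg a va)) (sym (fg b vb)) q))
    (λ q → subst₂ Q (fg a va) (fg b vb)
             (Equivalence.to (pres (g a) (g b) (g-ok a va) (g-ok b vb)) q))

module IsoFacts {θ S T} (φ : Iso θ S T) where
  open Iso φ public

  f-injective : ∀ {a a'} → Valid θ S a → Valid θ S a' → f a ≡ f a' → a ≡ a'
  f-injective {a} {a'} va va' e = trans (sym (gf a va)) (trans (cong g e) (gf a' va'))

  adj-pres : ∀ {a b} → Valid θ S a → Valid θ S b → Adj a b → Adj (f a) (f b)
  adj-pres {a} {b} va vb = Equivalence.to (adj a b va vb)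

  ord-pres : ∀ {a b} → Valid θ S a → Valid θ S b → Ord a b → Ord (f a) (f b)
  ord-pres {a} {b} va vb = Equivalence.to (ord a b va vb)

  inverse-image : ∀ {a b} → Valid θ S a → f a ≡ b → g b ≡ a
  inverse-image {a} va e = trans (cong g (sym e)) (gf a va)

  -- f fixes a core vertex once it fixes every smaller one: otherwise f x or g x lies
  -- strictly below x, or x ≤ f x and x ≤ g x, whence f x ≤ f (g x) = x.
  core-fixed-step : ∀ x → Core x → (∀ y → Core y → y ⊏ᶜ x → f y ≡ y) → f x ≡ x
  core-fixed-step x cx fixed-below = Sum.[ fixed-if-above , fixed-if-below ] (core-total cx (f x))
    where
    vxS : Valid θ S x
    vxS = core-valid S cx
    vxT : Valid θ T x
    vxT = core-valid T cx

    fixed-if-below : Ord (f x) x → f x ≡ x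
    fixed-if-below fx≤x with core-below T cx (f-ok x vxS) fx≤x
    ... | inj₁ fx≡x         = fx≡x
    ... | inj₂ (cfx , fx⊏x) = f-injective (core-valid S cfx) vxS (fixed-below (f x) cfx fx⊏x)

    inverse-fixed-if-below : Ord (g x) x → x ≡ g x
    inverse-fixed-if-below gx≤x with core-below S cx (g-ok x vxT) gx≤x
    ... | inj₁ gx≡x         = sym gx≡x
    ... | inj₂ (cgx , gx⊏x) = trans (sym (fg x vxT)) (fixed-below (g x) cgx gx⊏x)

    fixed-if-above : Ord x (f x) → f x ≡ x
    fixed-if-above x≤fx with core-total cx (g x)
    ... | inj₂ gx≤x = trans (cong f (inverse-fixed-if-below gx≤x)) (fg x vxT)
    ... | inj₁ x≤gx = sym (core-antisym cx x≤fx
            (subst (Ord (f x)) (fg x vxT) (ord-pres vxS (g-ok x vxT) x≤gx)))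

  core-fixed : ∀ x → Core x → f x ≡ x
  core-fixed x = go x (⊏ᶜ-wellFounded x)
    where
    go : ∀ x → Acc _⊏ᶜ_ x → Core x → f x ≡ x
    go x (acc below) cx = core-fixed-step x cx (λ y cy y⊏x → go y (below y⊏x) cy)

  hair-image-not-core : ∀ {u s x c} → Valid θ S (hair u s x) → Core c → f (hair u s x) ≢ c
  hair-image-not-core {c = c} va cc e =
    subst Core (sym (f-injective va (core-valid S cc) (trans e (sym (core-fixed c cc))))) cc

module HairImages {θ S T} (φ : Iso θ S T) where
  open IsoFacts φ

  -- The root of a hair at s is adjacent to s = f(s) and is not a core vertex.
  root-image : ∀ {u s} → S u s → ∃ λ v → f (hair u s []) ≡ hair v s []
  root-image {u} {s} Su with node-neighbour (subst (Adj (f (hair u s []))) (core-fixed (node s) tt)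
                               (adj-pres (ray-valid θ S Su 0) tt (inj₁ (hair-root u s))))
  ... | inj₁ (t , e) = ⊥-elim (hair-image-not-core (ray-valid θ S Su 0)
                               (subst (Valid θ T) e (f-ok _ (ray-valid θ S Su 0))) e)
  ... | inj₂ root    = root

  Ray : List Bool → List Bool → List ℕ → ℕ → Set
  Ray u v s k = ∀ j → j ≤ k → f (hair u s (zeros j)) ≡ hair v s (zeros j)

  ray-extend : ∀ {u v s k} → Ray u v s k →
    f (hair u s (zeros (suc k))) ≡ hair v s (zeros (suc k)) → Ray u v s (suc k)
  ray-extend ray next j j≤k+1 with m≤n⇒m<n∨m≡n j≤k+1
  ... | inj₁ (s≤s j≤k) = ray j j≤k
  ... | inj₂ refl      = next

  -- A child of the last vertex of the ray is not sent to s (a core vertex) nor to the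
  -- parent (the image of the previous ray vertex), so it goes to a child.
  child-image : ∀ {u v s k b} → Valid θ S (hair u s (zeros k ∷ʳ b)) → Ray u v s k →
    ∃ λ b' → f (hair u s (zeros k ∷ʳ b)) ≡ hair v s (zeros k ∷ʳ b')
  child-image {u} {v} {s} {k} {b} vc ray
    with hair-neighbour (subst (Adj (f (hair u s (zeros k ∷ʳ b)))) (ray k ≤-refl)
           (adj-pres vc (ray-valid θ S (proj₁ vc) k) (inj₁ (hair-pred u s (zeros k) b))))
  ... | inj₁ e = ⊥-elim (hair-image-not-core vc tt e)
  ... | inj₂ (inj₂ child) = child
  ... | inj₂ (inj₁ (y , b₀ , ek , e)) with zeros-parent k y b₀ ek
  ...   | k' , refl , refl = ⊥-elim (snoc-not-zeros k' b (hair-label-injective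
            (f-injective vc (ray-valid θ S (proj₁ vc) k') (trans e (sym (ray k' (n≤1+n k')))))))

module Inclusion {θ} (en : IsEnumeration θ) {S T} (φ : Iso θ S T) where
  open IsoFacts φ
  open HairImages φ
  private module Inverse = HairImages (symIso φ)

  -- If the ray of u leaves the ray of v at depth k, into the branch of v, then pulling
  -- back the zero child of v with g shows that k is the branch depth of u.
  leaving-depth : ∀ {u v s k} → S u s → Ray u v s k →
    f (hair u s (zeros k ∷ʳ false)) ≡ hair v s (zeros k ∷ʳ true) → k ≡ 2 * θ u + 2
  leaving-depth {u} {v} {s} {k} Su ray e = from-pullback (Inverse.child-image vz inverse-ray)
    where
    vm : Valid θ T (hair v s (zeros k ∷ʳ true))
    vm = subst (Valid θ T) e (f-ok _ (zero-child-valid θ S Su k))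
    vz : Valid θ T (hair v s (zeros k ∷ʳ false))
    vz = zero-child-valid θ T (proj₁ vm) k
    inverse-ray : ∀ j → j ≤ k → g (hair v s (zeros j)) ≡ hair u s (zeros j)
    inverse-ray j j≤k = inverse-image (ray-valid θ S Su j) (ray j j≤k)

    -- g (v , s , 0^(k) 0) is not (u , s , 0^(k) 0), whose image is (v , s , 0^(k) 1),
    -- so it is the branch child (u , s , 0^(k) 1), which exists only at depth 2θ(u)+2.
    from-pullback : (∃ λ b → g (hair v s (zeros k ∷ʳ false)) ≡ hair u s (zeros k ∷ʳ b)) →
      k ≡ 2 * θ u + 2
    from-pullback (true , e') = branch-depth θ u k (proj₂ (subst (Valid θ S) e' (g-ok _ vz)))
    from-pullback (false , e') with ∷ʳ-injectiveʳ (zeros k) (zeros k)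
      (hair-label-injective (trans (sym (fg _ vz)) (trans (cong f e') e)))
    ... | ()

  ray-to-branch : ∀ {u v s} → S u s → f (hair u s []) ≡ hair v s [] →
    ∀ k → k ≤ 2 * θ u + 2 → Ray u v s k
  ray-to-branch Su root zero    _   zero z≤n = root
  ray-to-branch {u} {v} {s} Su root (suc k) k<K = ray-extend ray next
    where
    ray : Ray u v s k
    ray = ray-to-branch Su root k (<⇒≤ k<K)
    next : f (hair u s (zeros (suc k))) ≡ hair v s (zeros (suc k))
    next with child-image (zero-child-valid θ S Su k) ray
    ... | false , e = subst (λ x → f (hair u s x) ≡ hair v s x) (sym (zeros-suc k)) e
    ... | true  , e = ⊥-elim (<-irrefl (leaving-depth Su ray e) k<K)

  branch-image : ∀ {u v s a} → Valid θ S a →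
    f a ≡ hair v s (zeros (2 * θ u + 2) ∷ʳ true) → T u s
  branch-image {u} {v} {s} va e =
    subst (λ w → T w s) (sym (branch-depth-injective en u v (branch-depth θ v _ (proj₂ vm))))
      (proj₁ vm)
    where
    vm : Valid θ T (hair v s (zeros (2 * θ u + 2) ∷ʳ true))
    vm = subst (Valid θ T) e (f-ok _ va)

  inclusion : ∀ {u s} → S u s → T u s
  inclusion {u} {s} Su = from-children (child-image zero-child ray) (child-image branch-child ray)
    where
    K : ℕ
    K = 2 * θ u + 2
    v : List Bool
    v = proj₁ (root-image Su)
    ray : Ray u v s K
    ray = ray-to-branch Su (proj₂ (root-image Su)) K ≤-refl
    zero-child : Valid θ S (hair u s (zeros K ∷ʳ false))
    zero-child = zero-child-valid θ S Su K
    branch-child : Valid θ S (hair u s (zeros K ∷ʳ true))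
    branch-child = branch-child-valid θ S Su

    -- The two children of (u , s , 0^(K)) have distinct images among the children of
    -- (v , s , 0^(K)), so one of them is the branch child.
    from-children :
      (∃ λ b → f (hair u s (zeros K ∷ʳ false)) ≡ hair v s (zeros K ∷ʳ b)) →
      (∃ λ b → f (hair u s (zeros K ∷ʳ true)) ≡ hair v s (zeros K ∷ʳ b)) → T u s
    from-children (true , e)  _           = branch-image zero-child e
    from-children _           (true , e)  = branch-image branch-child e
    from-children (false , e) (false , e')
      with ∷ʳ-injectiveʳ (zeros K) (zeros K)
             (hair-label-injective (f-injective zero-child branch-child (trans e (sym e'))))
    ... | ()

lemma3p1 : (θ : List Bool → ℕ) → IsEnumeration θ →
    (S T : Tree) → IsNormalTree S → IsNormalTree T →
    ¬ (∀ u s → S u s ⇔ T u s) →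
    ¬ Iso θ S T
lemma3p1 θ en S T _ _ S≢T φ =
  S≢T λ u s → mk⇔ (Inclusion.inclusion en φ) (Inclusion.inclusion en (symIso φ))
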